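{- Let $k\ge 1$. For every $n\ge k+2$, the coefficient of $x^{n-k-1}$ in $R_n^{(k\le\max,\emptyset,0,0)}(x)$ equals $(k-1)!\left(\binom{n}{2}-\binom{k-1}{2}\right)$.
   Context: For $\sigma=\sigma_1\cdots\sigma_n\in S_n$, $\sigma_i$ matches $MMP(k\le\max,\emptyset,0,0)$ if no $j<i$ has $\sigma_j>\sigma_i$, and, with $\sigma_m=\max\{\sigma_{i+1},\dots,\sigma_n\}$ ($i<n$), at least $k$ of $\sigma_{i+1},\dots,\sigma_m$ are greater than $\sigma_i$. $mmp^{(k\le\max,\emptyset,0,0)}(\sigma)$ is the number of such $i$, and $R_n^{(k\le\max,\emptyset,0,0)}(x)=\sum_{\sigma\in S_n}x^{mmp^{(k\le\max,\emptyset,0,0)}(\sigma)}$. Binomial coefficients $\binom{m}{2}$ are $0$ for $m<2$. -}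

module Defs where

open import Data.Nat using (ℕ; zero; suc; _+_; _*_; _∸_; _<ᵇ_; _≤ᵇ_; _⊔_)
open import Data.Bool using (Bool; true; false; if_then_else_; not; _∧_)
open import Data.List using (List; []; _∷_; map; concatMap; length; upTo; filterᵇ; reverse)

insertions : ℕ → List ℕ → List (List ℕ)
insertions x [] = (x ∷ []) ∷ []
insertions x (y ∷ ys) = (x ∷ y ∷ ys) ∷ map (y ∷_) (insertions x ys)

perms : List ℕ → List (List ℕ)
perms [] = [] ∷ []
perms (x ∷ xs) = concatMap (insertions x) (perms xs)

oneTo : ℕ → List ℕ
oneTo n = map suc (upTo n)

-- S_n, each permutation σ = σ₁⋯σₙ in one-line notation, listed exactly once.
Sn : ℕ → List (List ℕ)
Sn n = perms (oneTo n)

-- maximum of a list (0 for the empty list; entries are ≥ 1)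
maxL : List ℕ → ℕ
maxL [] = 0
maxL (x ∷ xs) = x ⊔ maxL xs

upToFirst : ℕ → List ℕ → List ℕ
upToFirst m [] = []
upToFirst m (x ∷ xs) = if x Data.Nat.≡ᵇ m then x ∷ [] else x ∷ upToFirst m xs

countGreater : ℕ → List ℕ → ℕ
countGreater a xs = length (filterᵇ (a <ᵇ_) xs)

-- For σᵢ = a with suffix rest = σᵢ₊₁⋯σₙ (nonempty), the condition:
-- at least k of σᵢ₊₁,…,σₘ exceed a, where σₘ = max of rest.
suffixCond : ℕ → ℕ → List ℕ → Bool
suffixCond k a [] = false
suffixCond k a (y ∷ ys) = k ≤ᵇ countGreater a (upToFirst (maxL (y ∷ ys)) (y ∷ ys))

-- mmp statistic; pm = maximum of the prefix σ₁⋯σᵢ₋₁ (0 if empty).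
-- σᵢ is a left-to-right maximum iff no earlier entry exceeds it, i.e. not (σᵢ < pm).
mmpGo : ℕ → ℕ → List ℕ → ℕ
mmpGo k pm [] = 0
mmpGo k pm (a ∷ rest) =
  (if not (a <ᵇ pm) ∧ suffixCond k a rest then 1 else 0) + mmpGo k (pm ⊔ a) rest

mmp : ℕ → List ℕ → ℕ
mmp k σ = mmpGo k 0 σ

-- coefficient of x^j in R_n^{(k≤max,∅,0,0)}(x) = #{σ ∈ S_n : mmp σ = j}
coeffR : ℕ → ℕ → ℕ → ℕ
coeffR k n j = length (filterᵇ (λ σ → mmp k σ Data.Nat.≡ᵇ j) (Sn n))

module Submission where

-- Every σ ∈ Sₙ arises exactly once by inserting the letter 1 into a permutation τ of
-- {2,…,n}.  Let j = mmp τ and let q be the position of the maximum of τ.  Inserting 1 in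
-- front makes it a new left-to-right maximum followed by q larger entries up to the maximum,
-- so mmp grows by [k ≤ q] and the maximum moves to q + 1; inserting it anywhere else leaves
-- mmp unchanged and moves the maximum one step iff 1 lands before it.  Hence the profiles
-- (j, q) obey an explicit recursion.  In the coordinates h = (q − k) − j (the shortfall of mmp
-- below q − k) and D = n − q, the coefficient of x^(n−k−1) counts the profiles with
-- (h, D) ∈ {(1,0), (0,1)}.  Together with (0,0) these counts satisfy a triangular linear
-- recursion, solved by (k−1)!·(C(n−1,2) − C(k−1,2)) for (1,0) and (k−1)!·(n−1) for (0,1).

open import Defs
open import Data.Bool using (Bool; true; false; if_then_else_; not; _∧_)
open import Data.Bool.Properties using (if-float)
open import Data.List using (List; []; _∷_; _++_; map; concat; concatMap; length; filterᵇ; replicate; applyUpTo; upTo)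
open import Data.List.Properties
  using (map-++; map-replicate; map-applyUpTo; map-upTo; map-cong; map-cong-local; map-concatMap; concatMap-map; length-map; length-upTo)
open import Data.List.Relation.Unary.All as All using (All; []; _∷_)
open import Data.List.Relation.Unary.All.Properties using (concat⁺; map⁺; ++⁺; replicate⁺)
open import Data.List.Relation.Unary.AllPairs using (AllPairs; []; _∷_)
import Data.List.Relation.Unary.AllPairs.Properties as AllPairs
open import Data.List.Relation.Unary.Any as Any using (Any; here; there)
open import Data.Nat using (ℕ; zero; suc; _+_; _*_; _∸_; _≤_; _<_; _<ᵇ_; _≤ᵇ_; _≡ᵇ_; _⊔_; z≤n; s≤s; _!; _≤?_; _<?_; _≟_)
open import Data.Nat.Combinatorics using (_C_; nC1≡n; nCk+nC[k+1]≡[n+1]C[k+1])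
open import Data.Nat.Properties
open import Algebra.Properties.CommutativeSemigroup +-commutativeSemigroup using (interchange; xy∙z≈xz∙y)
open import Data.Nat.Tactic.RingSolver using (solve-∀)
open import Data.Product using (_×_; _,_; proj₁)
open import Data.Sum as Sum using (_⊎_; inj₁; inj₂)
open import Function using (_∘_)
open import Relation.Binary.PropositionalEquality
open import Relation.Nullary using (contradiction; yes; no)
open import Relation.Nullary.Decidable using (dec-true; dec-false)

private variable
  A B : Set

≤⇒≤ᵇ≡true : ∀ {m n} → m ≤ n → (m ≤ᵇ n) ≡ true
≤⇒≤ᵇ≡true = dec-true (_ ≤? _)

>⇒≤ᵇ≡false : ∀ {m n} → n < m → (m ≤ᵇ n) ≡ false
>⇒≤ᵇ≡false n<m = dec-false (_ ≤? _) (<⇒≱ n<m)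

<⇒<ᵇ≡true : ∀ {m n} → m < n → (m <ᵇ n) ≡ true
<⇒<ᵇ≡true = dec-true (_ <? _)

≥⇒<ᵇ≡false : ∀ {m n} → n ≤ m → (m <ᵇ n) ≡ false
≥⇒<ᵇ≡false n≤m = dec-false (_ <? _) (≤⇒≯ n≤m)

≢⇒≡ᵇ≡false : ∀ {m n} → m ≢ n → (m ≡ᵇ n) ≡ false
≢⇒≡ᵇ≡false = dec-false (_ ≟ _)

≡ᵇ-refl : ∀ m → (m ≡ᵇ m) ≡ true
≡ᵇ-refl m = dec-true (m ≟ m) refl

𝟙 : Bool → ℕ
𝟙 b = if b then 1 else 0

countᵇ : (A → Bool) → List A → ℕ
countᵇ p [] = 0
countᵇ p (x ∷ xs) = 𝟙 (p x) + countᵇ p xs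

length-filterᵇ : ∀ (p : A → Bool) xs → length (filterᵇ p xs) ≡ countᵇ p xs
length-filterᵇ p [] = refl
length-filterᵇ p (x ∷ xs) with p x
... | true = cong suc (length-filterᵇ p xs)
... | false = length-filterᵇ p xs

countᵇ-map : ∀ (p : B → Bool) (f : A → B) xs → countᵇ p (map f xs) ≡ countᵇ (p ∘ f) xs
countᵇ-map p f [] = refl
countᵇ-map p f (x ∷ xs) = cong (𝟙 (p (f x)) +_) (countᵇ-map p f xs)

countᵇ-++ : ∀ (p : A → Bool) xs ys → countᵇ p (xs ++ ys) ≡ countᵇ p xs + countᵇ p ys
countᵇ-++ p [] ys = refl
countᵇ-++ p (x ∷ xs) ys = trans (cong (𝟙 (p x) +_) (countᵇ-++ p xs ys)) (sym (+-assoc (𝟙 (p x)) _ _))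

countᵇ-replicate : ∀ (p : A → Bool) n x → countᵇ p (replicate n x) ≡ (if p x then n else 0)
countᵇ-replicate p n x with p x in px
... | true = go n
  where
    go : ∀ n → countᵇ p (replicate n x) ≡ n
    go zero = refl
    go (suc n) rewrite px = cong suc (go n)
... | false = go n
  where
    go : ∀ n → countᵇ p (replicate n x) ≡ 0
    go zero = refl
    go (suc n) rewrite px = go n

countᵇ-all : ∀ {p : A → Bool} {xs} → All (λ x → p x ≡ true) xs → countᵇ p xs ≡ length xs
countᵇ-all [] = refl
countᵇ-all (px ∷ pxs) rewrite px = cong suc (countᵇ-all pxs)

countᵇ-split : ∀ (p q r : A → Bool) {xs} → All (λ x → 𝟙 (p x) ≡ 𝟙 (q x) + 𝟙 (r x)) xs →
  countᵇ p xs ≡ countᵇ q xs + countᵇ r xs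
countᵇ-split p q r [] = refl
countᵇ-split p q r {x ∷ xs} (e ∷ es) rewrite e | countᵇ-split p q r es =
  interchange (𝟙 (q x)) (𝟙 (r x)) (countᵇ q xs) (countᵇ r xs)

if-else-0≡𝟙* : ∀ b n → (if b then n else 0) ≡ 𝟙 b * n
if-else-0≡𝟙* true n = sym (+-identityʳ n)
if-else-0≡𝟙* false n = refl

countᵇ-concatMap : ∀ (p : B → Bool) (q r : A → Bool) α β (f : A → List B) xs →
  (∀ x → countᵇ p (f x) ≡ (if q x then α else 0) + (if r x then β else 0)) →
  countᵇ p (concatMap f xs) ≡ countᵇ q xs * α + countᵇ r xs * β
countᵇ-concatMap p q r α β f [] _ = refl
countᵇ-concatMap p q r α β f (x ∷ xs) count-f = begin
  countᵇ p (f x ++ concatMap f xs)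
    ≡⟨ countᵇ-++ p (f x) (concatMap f xs) ⟩
  countᵇ p (f x) + countᵇ p (concatMap f xs)
    ≡⟨ cong₂ _+_ (count-f x) (countᵇ-concatMap p q r α β f xs count-f) ⟩
  (if q x then α else 0) + (if r x then β else 0) + (countᵇ q xs * α + countᵇ r xs * β)
    ≡⟨ cong₂ (λ u v → u + v + _) (if-else-0≡𝟙* (q x) α) (if-else-0≡𝟙* (r x) β) ⟩
  𝟙 (q x) * α + 𝟙 (r x) * β + (countᵇ q xs * α + countᵇ r xs * β)
    ≡⟨ interchange (𝟙 (q x) * α) (𝟙 (r x) * β) (countᵇ q xs * α) (countᵇ r xs * β) ⟩
  𝟙 (q x) * α + countᵇ q xs * α + (𝟙 (r x) * β + countᵇ r xs * β)
    ≡⟨ sym (cong₂ _+_ (*-distribʳ-+ α (𝟙 (q x)) (countᵇ q xs)) (*-distribʳ-+ β (𝟙 (r x)) (countᵇ r xs))) ⟩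
  (𝟙 (q x) + countᵇ q xs) * α + (𝟙 (r x) + countᵇ r xs) * β ∎
  where open ≡-Reasoning

applyUpTo-cong : ∀ {f g : ℕ → A} → (∀ i → f i ≡ g i) → ∀ n → applyUpTo f n ≡ applyUpTo g n
applyUpTo-cong {f = f} {g} f≗g n = trans (sym (map-upTo f n)) (trans (map-cong f≗g (upTo n)) (map-upTo g n))

applyUpTo-threshold : ∀ (a b : A) q m → q ≤ suc m →
  applyUpTo (λ i → if suc i <ᵇ q then a else b) m ≡ replicate (q ∸ 1) a ++ replicate (m ∸ (q ∸ 1)) b
applyUpTo-threshold a b zero zero _ = refl
applyUpTo-threshold a b (suc zero) zero _ = refl
applyUpTo-threshold a b (suc (suc q)) zero (s≤s ())
applyUpTo-threshold a b zero (suc m) _ = cong (b ∷_) (applyUpTo-threshold a b zero m z≤n)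
applyUpTo-threshold a b (suc zero) (suc m) _ = cong (b ∷_) (applyUpTo-threshold a b zero m z≤n)
applyUpTo-threshold a b (suc (suc q)) (suc m) (s≤s q<1+m) = cong (a ∷_) (applyUpTo-threshold a b (suc q) m q<1+m)

-- Positions past the end insert at the end.
insertAtℕ : ℕ → A → List A → List A
insertAtℕ zero x ys = x ∷ ys
insertAtℕ (suc i) x [] = x ∷ []
insertAtℕ (suc i) x (y ∷ ys) = y ∷ insertAtℕ i x ys

insertions-insertAtℕ : ∀ x ys → insertions x ys ≡ applyUpTo (λ i → insertAtℕ i x ys) (suc (length ys))
insertions-insertAtℕ x [] = refl
insertions-insertAtℕ x (y ∷ ys) = cong ((x ∷ y ∷ ys) ∷_) (begin
  map (y ∷_) (insertions x ys)
    ≡⟨ cong (map (y ∷_)) (insertions-insertAtℕ x ys) ⟩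
  map (y ∷_) (applyUpTo (λ i → insertAtℕ i x ys) (suc (length ys)))
    ≡⟨ map-applyUpTo (λ i → insertAtℕ i x ys) (y ∷_) (suc (length ys)) ⟩
  applyUpTo (λ i → insertAtℕ (suc i) x (y ∷ ys)) (length (y ∷ ys)) ∎)
  where open ≡-Reasoning

length-insertAtℕ : ∀ i (x : A) ys → length (insertAtℕ i x ys) ≡ suc (length ys)
length-insertAtℕ zero x ys = refl
length-insertAtℕ (suc i) x [] = refl
length-insertAtℕ (suc i) x (y ∷ ys) = cong suc (length-insertAtℕ i x ys)

countᵇ-insertAtℕ : ∀ {p : A → Bool} {x} i ys → p x ≡ false → countᵇ p (insertAtℕ i x ys) ≡ countᵇ p ys
countᵇ-insertAtℕ zero ys px rewrite px = refl
countᵇ-insertAtℕ (suc i) [] px rewrite px = refl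
countᵇ-insertAtℕ {p = p} (suc i) (y ∷ ys) px = cong (𝟙 (p y) +_) (countᵇ-insertAtℕ i ys px)

maxL-insertAtℕ : ∀ i x ys → maxL (insertAtℕ i x ys) ≡ x ⊔ maxL ys
maxL-insertAtℕ zero x ys = refl
maxL-insertAtℕ (suc i) x [] = refl
maxL-insertAtℕ (suc i) x (y ∷ ys) = begin
  y ⊔ maxL (insertAtℕ i x ys) ≡⟨ cong (y ⊔_) (maxL-insertAtℕ i x ys) ⟩
  y ⊔ (x ⊔ maxL ys)           ≡⟨ sym (⊔-assoc y x (maxL ys)) ⟩
  y ⊔ x ⊔ maxL ys             ≡⟨ cong (_⊔ maxL ys) (⊔-comm y x) ⟩
  x ⊔ y ⊔ maxL ys             ≡⟨ ⊔-assoc x y (maxL ys) ⟩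
  x ⊔ (y ⊔ maxL ys)           ∎
  where open ≡-Reasoning

maxL-∈ : ∀ z zs → Any (maxL (z ∷ zs) ≡_) (z ∷ zs)
maxL-∈ z [] = here (⊔-identityʳ z)
maxL-∈ z (w ∷ ws) with ⊔-sel z (maxL (w ∷ ws))
... | inj₁ max≡z = here max≡z
... | inj₂ max≡rest = there (Any.map (trans max≡rest) (maxL-∈ w ws))

All<⇒<maxL : ∀ {x z zs} → All (x <_) (z ∷ zs) → x < maxL (z ∷ zs)
All<⇒<maxL {z = z} {zs} (x<z ∷ _) = <-≤-trans x<z (m≤m⊔n z (maxL zs))

All-upToFirst : ∀ {P : ℕ → Set} M {L} → All P L → All P (upToFirst M L)
All-upToFirst M [] = []
All-upToFirst M {z ∷ zs} (pz ∷ pzs) with z ≡ᵇ M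
... | true = pz ∷ []
... | false = pz ∷ All-upToFirst M pzs

length-upToFirst-≤ : ∀ M L → length (upToFirst M L) ≤ length L
length-upToFirst-≤ M [] = z≤n
length-upToFirst-≤ M (z ∷ zs) with z ≡ᵇ M
... | true = s≤s z≤n
... | false = s≤s (length-upToFirst-≤ M zs)

upToFirst-insertAtℕ : ∀ {M x} i L → x ≢ M → Any (M ≡_) L →
  upToFirst M (insertAtℕ i x L) ≡
    (if i <ᵇ length (upToFirst M L) then insertAtℕ i x (upToFirst M L) else upToFirst M L)
upToFirst-insertAtℕ {M} zero (z ∷ zs) x≢M _ rewrite ≢⇒≡ᵇ≡false x≢M with z ≡ᵇ M
... | true = refl
... | false = refl
upToFirst-insertAtℕ {M} {x} (suc i) (z ∷ zs) x≢M M∈L with z ≡ᵇ M in z≟M | M∈L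
... | true | _ = refl
... | false | here refl with () ← trans (sym (≡ᵇ-refl z)) z≟M
... | false | there M∈zs = trans (cong (z ∷_) (upToFirst-insertAtℕ i zs x≢M M∈zs)) (if-float (z ∷_) (i <ᵇ length (upToFirst M zs)))

countGreater-upToFirst-insertAtℕ : ∀ {y x M} i L → x ≤ y → x ≢ M → Any (M ≡_) L →
  countGreater y (upToFirst M (insertAtℕ i x L)) ≡ countGreater y (upToFirst M L)
countGreater-upToFirst-insertAtℕ {y} {x} {M} i L x≤y x≢M M∈L
  rewrite upToFirst-insertAtℕ i L x≢M M∈L
        | length-filterᵇ (y <ᵇ_) (upToFirst M L)
  with i <ᵇ length (upToFirst M L)
... | true = trans (length-filterᵇ (y <ᵇ_) (insertAtℕ i x (upToFirst M L)))
                   (countᵇ-insertAtℕ i (upToFirst M L) (≥⇒<ᵇ≡false x≤y))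
... | false = length-filterᵇ (y <ᵇ_) (upToFirst M L)

countGreater-upToFirst-all : ∀ {x} M L → All (x <_) L → countGreater x (upToFirst M L) ≡ length (upToFirst M L)
countGreater-upToFirst-all {x} M L x<L =
  trans (length-filterᵇ (x <ᵇ_) (upToFirst M L)) (countᵇ-all (All.map <⇒<ᵇ≡true (All-upToFirst M x<L)))

maxPos : List ℕ → ℕ
maxPos σ = length (upToFirst (maxL σ) σ)

maxPos-∷-below : ∀ {x} τ → All (x <_) τ → maxPos (x ∷ τ) ≡ suc (maxPos τ)
maxPos-∷-below {x} [] _ rewrite ⊔-identityʳ x | ≡ᵇ-refl x = refl
maxPos-∷-below {x} (z ∷ zs) x<τ
  rewrite m≤n⇒m⊔n≡n (<⇒≤ (All<⇒<maxL x<τ)) | ≢⇒≡ᵇ≡false (<⇒≢ (All<⇒<maxL x<τ)) = refl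

maxPos-insertAtℕ : ∀ {x} i z zs → All (x <_) (z ∷ zs) →
  maxPos (insertAtℕ i x (z ∷ zs)) ≡
    (if i <ᵇ maxPos (z ∷ zs) then suc (maxPos (z ∷ zs)) else maxPos (z ∷ zs))
maxPos-insertAtℕ {x} i z zs x<τ
  rewrite maxL-insertAtℕ i x (z ∷ zs) | m≤n⇒m⊔n≡n (<⇒≤ (All<⇒<maxL x<τ))
        | upToFirst-insertAtℕ i (z ∷ zs) (<⇒≢ (All<⇒<maxL x<τ)) (maxL-∈ z zs)
  = trans (if-float length (i <ᵇ maxPos (z ∷ zs)))
          (cong (λ n → if i <ᵇ maxPos (z ∷ zs) then n else maxPos (z ∷ zs))
                (length-insertAtℕ i x (upToFirst (maxL (z ∷ zs)) (z ∷ zs))))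

maxPos-≤-length : ∀ σ → maxPos σ ≤ length σ
maxPos-≤-length σ = length-upToFirst-≤ (maxL σ) σ

suffixCount : ℕ → List ℕ → ℕ
suffixCount y L = countGreater y (upToFirst (maxL L) L)

suffixCount-insertAtℕ : ∀ {x y} i z zs → x < y → All (x <_) (z ∷ zs) →
  suffixCount y (insertAtℕ i x (z ∷ zs)) ≡ suffixCount y (z ∷ zs)
suffixCount-insertAtℕ {x} i z zs x<y x<L
  rewrite maxL-insertAtℕ i x (z ∷ zs) | m≤n⇒m⊔n≡n (<⇒≤ (All<⇒<maxL x<L))
  = countGreater-upToFirst-insertAtℕ i (z ∷ zs) (<⇒≤ x<y) (<⇒≢ (All<⇒<maxL x<L)) (maxL-∈ z zs)

All-insertions : ∀ {P : ℕ → Set} {x τ} → P x → All P τ →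
  All (λ σ → All P σ × length σ ≡ suc (length τ)) (insertions x τ)
All-insertions {τ = []} px [] = (px ∷ [] , refl) ∷ []
All-insertions {τ = y ∷ ys} px (py ∷ pys) = (px ∷ py ∷ pys , refl) ∷
  map⁺ (All.map (λ (pσ , len) → py ∷ pσ , cong suc len) (All-insertions px pys))

All-perms : ∀ {P : ℕ → Set} {L} → All P L → All (λ σ → All P σ × length σ ≡ length L) (perms L)
All-perms [] = ([] , refl) ∷ []
All-perms {P} {x ∷ xs} (px ∷ pxs) = concat⁺ (map⁺ (All.map insertions-x (All-perms pxs)))
  where
    insertions-x : ∀ {σ} → All P σ × length σ ≡ length xs →
      All (λ σ′ → All P σ′ × length σ′ ≡ suc (length xs)) (insertions x σ)
    insertions-x {σ} (pσ , len) =
      subst (λ n → All (λ σ′ → All P σ′ × length σ′ ≡ suc n) (insertions x σ)) len (All-insertions px pσ)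

AllPairs-oneTo : ∀ n → AllPairs _<_ (oneTo n)
AllPairs-oneTo n = AllPairs.map⁺ (AllPairs.applyUpTo⁺₁ (λ i → i) n (λ i<j _ → s≤s i<j))

length-oneTo : ∀ n → length (oneTo n) ≡ n
length-oneTo n = trans (length-map suc (upTo n)) (length-upTo n)

-- Comparing second components first lets the test reduce on pairs (h + 𝟙 b , D) with b unknown.
_=ᵇ_ : ℕ × ℕ → ℕ × ℕ → Bool
(u , v) =ᵇ (h , d) = (v ≡ᵇ d) ∧ (u ≡ᵇ h)

m+n+o+p≡n+[m+[o+p]] : ∀ m n o p → m + n + o + p ≡ n + (m + (o + p))
m+n+o+p≡n+[m+[o+p]] = solve-∀

m+n+o+p∸n≡m+[o+p] : ∀ m n o p → m + n + o + p ∸ n ≡ m + (o + p)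
m+n+o+p∸n≡m+[o+p] m n o p = trans (cong (_∸ n) (m+n+o+p≡n+[m+[o+p]] m n o p)) (m+n∸m≡n n (m + (o + p)))

m+n+o∸n∸m≡o : ∀ m n o → m + n + o ∸ n ∸ m ≡ o
m+n+o∸n∸m≡o m n o = begin
  m + n + o ∸ n ∸ m   ≡⟨ ∸-+-assoc (m + n + o) n m ⟩
  m + n + o ∸ (n + m) ≡⟨ cong (m + n + o ∸_) (+-comm n m) ⟩
  m + n + o ∸ (m + n) ≡⟨ m+n∸m≡n (m + n) o ⟩
  o                   ∎
  where open ≡-Reasoning

C2-suc : ∀ n → n C 2 + n ≡ suc n C 2
C2-suc n = trans (+-comm (n C 2) n)
  (trans (cong (_+ n C 2) (sym (nC1≡n n))) (nCk+nC[k+1]≡[n+1]C[k+1] n 1))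

𝟙-≡ᵇ-pred : ∀ j e → 2 ≤ j + e → 𝟙 (j ≡ᵇ j + e ∸ 1) ≡ 𝟙 (e ≡ᵇ 1)
𝟙-≡ᵇ-pred zero zero ()
𝟙-≡ᵇ-pred (suc zero) zero (s≤s ())
𝟙-≡ᵇ-pred (suc (suc j)) zero _ rewrite +-identityʳ j = cong 𝟙 (≢⇒≡ᵇ≡false (≢-sym (<⇒≢ (n<1+n j))))
𝟙-≡ᵇ-pred j (suc zero) _ rewrite m+n∸n≡m j 1 | ≡ᵇ-refl j = refl
𝟙-≡ᵇ-pred j (suc (suc e)) _ rewrite +-∸-assoc j {2 + e} {1} (s≤s z≤n) | +-suc j e = cong 𝟙 (≢⇒≡ᵇ≡false (m≢1+m+n j))

𝟙-+≡ᵇ1 : ∀ h D → 𝟙 (h + D ≡ᵇ 1) ≡ 𝟙 ((1 , 0) =ᵇ (h , D)) + 𝟙 ((0 , 1) =ᵇ (h , D))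
𝟙-+≡ᵇ1 zero zero = refl
𝟙-+≡ᵇ1 zero (suc zero) = refl
𝟙-+≡ᵇ1 zero (suc (suc D)) = refl
𝟙-+≡ᵇ1 (suc zero) zero = refl
𝟙-+≡ᵇ1 (suc zero) (suc zero) = refl
𝟙-+≡ᵇ1 (suc zero) (suc (suc D)) = refl
𝟙-+≡ᵇ1 (suc (suc h)) zero = refl
𝟙-+≡ᵇ1 (suc (suc h)) (suc zero) = refl
𝟙-+≡ᵇ1 (suc (suc h)) (suc (suc D)) = refl

module _ (k₀ : ℕ) where

  private
    k : ℕ
    k = suc k₀

  -- Inserting the smallest letter

  suffixCond-insertAtℕ : ∀ {x y} i L → x < y → All (x <_) L →
    suffixCond k y (insertAtℕ i x L) ≡ suffixCond k y L
  suffixCond-insertAtℕ {x} {y} i [] x<y _ = singleton i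
    where
      singleton : ∀ i → suffixCond k y (insertAtℕ i x []) ≡ false
      singleton zero rewrite ⊔-identityʳ x | ≡ᵇ-refl x | ≥⇒<ᵇ≡false (<⇒≤ x<y) = refl
      singleton (suc i) rewrite ⊔-identityʳ x | ≡ᵇ-refl x | ≥⇒<ᵇ≡false (<⇒≤ x<y) = refl
  suffixCond-insertAtℕ zero (z ∷ zs) x<y x<L = cong (k ≤ᵇ_) (suffixCount-insertAtℕ zero z zs x<y x<L)
  suffixCond-insertAtℕ (suc i) (z ∷ zs) x<y x<L = cong (k ≤ᵇ_) (suffixCount-insertAtℕ (suc i) z zs x<y x<L)

  mutual
    mmpGo-insertAtℕ-dominated : ∀ {x} pm i τ → x < pm → All (x <_) τ →
      mmpGo k pm (insertAtℕ i x τ) ≡ mmpGo k pm τ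
    mmpGo-insertAtℕ-dominated pm zero τ x<pm _ rewrite <⇒<ᵇ≡true x<pm | m≥n⇒m⊔n≡m (<⇒≤ x<pm) = refl
    mmpGo-insertAtℕ-dominated pm (suc i) [] x<pm _ rewrite <⇒<ᵇ≡true x<pm = refl
    mmpGo-insertAtℕ-dominated pm (suc i) (y ∷ τ) _ (x<y ∷ x<τ) = mmpGo-insertAtℕ-behind pm i y τ x<y x<τ

    mmpGo-insertAtℕ-behind : ∀ {x} pm i y τ → x < y → All (x <_) τ →
      mmpGo k pm (insertAtℕ (suc i) x (y ∷ τ)) ≡ mmpGo k pm (y ∷ τ)
    mmpGo-insertAtℕ-behind pm i y τ x<y x<τ = cong₂ _+_
      (cong (λ b → 𝟙 (not (y <ᵇ pm) ∧ b)) (suffixCond-insertAtℕ i τ x<y x<τ))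
      (mmpGo-insertAtℕ-dominated (pm ⊔ y) i τ (<-≤-trans x<y (m≤n⊔m pm y)) x<τ)

  mmpGo-below : ∀ {x} τ → All (x <_) τ → mmpGo k x τ ≡ mmp k τ
  mmpGo-below [] _ = refl
  mmpGo-below {x} (y ∷ τ) (x<y ∷ _) rewrite ≥⇒<ᵇ≡false (<⇒≤ x<y) | m≤n⇒m⊔n≡n (<⇒≤ x<y) = refl

  suffixCond-below : ∀ {x} τ → All (x <_) τ → suffixCond k x τ ≡ (k ≤ᵇ maxPos τ)
  suffixCond-below [] _ = refl
  suffixCond-below (z ∷ zs) x<τ = cong (k ≤ᵇ_) (countGreater-upToFirst-all (maxL (z ∷ zs)) (z ∷ zs) x<τ)

  profile : List ℕ → ℕ × ℕ
  profile σ = mmp k σ , maxPos σ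

  profile-∷-below : ∀ {x} τ → All (x <_) τ → profile (x ∷ τ) ≡ (mmp k τ + 𝟙 (k ≤ᵇ maxPos τ) , suc (maxPos τ))
  profile-∷-below τ x<τ = cong₂ _,_
    (trans (cong₂ _+_ (cong 𝟙 (suffixCond-below τ x<τ)) (mmpGo-below τ x<τ)) (+-comm _ (mmp k τ)))
    (maxPos-∷-below τ x<τ)

  profile-insertAtℕ-suc : ∀ {x} i z zs → All (x <_) (z ∷ zs) →
    profile (insertAtℕ (suc i) x (z ∷ zs)) ≡
      (if suc i <ᵇ maxPos (z ∷ zs) then (mmp k (z ∷ zs) , suc (maxPos (z ∷ zs))) else profile (z ∷ zs))
  profile-insertAtℕ-suc i z zs x<τ@(x<z ∷ x<zs) = trans
    (cong₂ _,_ (mmpGo-insertAtℕ-behind 0 i z zs x<z x<zs) (maxPos-insertAtℕ (suc i) z zs x<τ))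
    (if-float (mmp k (z ∷ zs) ,_) (suc i <ᵇ maxPos (z ∷ zs)))

  insertProfile : ℕ → ℕ × ℕ → List (ℕ × ℕ)
  insertProfile m (j , q) =
    (j + 𝟙 (k ≤ᵇ q) , suc q) ∷ (replicate (q ∸ 1) (j , suc q) ++ replicate (m ∸ (q ∸ 1)) (j , q))

  map-profile-insertions : ∀ {x} τ → All (x <_) τ → map profile (insertions x τ) ≡ insertProfile (length τ) (profile τ)
  map-profile-insertions {x} τ x<τ = begin
    map profile (insertions x τ)
      ≡⟨ cong (map profile) (insertions-insertAtℕ x τ) ⟩
    map profile (applyUpTo (λ i → insertAtℕ i x τ) (suc (length τ)))
      ≡⟨ map-applyUpTo (λ i → insertAtℕ i x τ) profile (suc (length τ)) ⟩
    profile (x ∷ τ) ∷ applyUpTo (λ i → profile (insertAtℕ (suc i) x τ)) (length τ)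
      ≡⟨ cong₂ _∷_ (profile-∷-below τ x<τ) (later τ x<τ) ⟩
    insertProfile (length τ) (profile τ) ∎
    where
      open ≡-Reasoning
      later : ∀ τ → All (x <_) τ → applyUpTo (λ i → profile (insertAtℕ (suc i) x τ)) (length τ) ≡
        replicate (maxPos τ ∸ 1) (mmp k τ , suc (maxPos τ)) ++ replicate (length τ ∸ (maxPos τ ∸ 1)) (profile τ)
      later [] _ = refl
      later τ@(z ∷ zs) x<τ = trans
        (applyUpTo-cong (λ i → profile-insertAtℕ-suc i z zs x<τ) (length τ))
        (applyUpTo-threshold _ _ (maxPos τ) (length τ) (m≤n⇒m≤1+n (maxPos-≤-length τ)))

  profiles : ℕ → List (ℕ × ℕ)
  profiles zero = (0 , 0) ∷ []
  profiles (suc m) = concatMap (insertProfile m) (profiles m)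

  map-profile-perms : ∀ {L} → AllPairs _<_ L → map profile (perms L) ≡ profiles (length L)
  map-profile-perms [] = refl
  map-profile-perms {x ∷ xs} (x<xs ∷ sorted) = begin
    map profile (concatMap (insertions x) (perms xs))
      ≡⟨ map-concatMap profile (insertions x) (perms xs) ⟩
    concatMap (λ σ → map profile (insertions x σ)) (perms xs)
      ≡⟨ cong concat (map-cong-local (All.map insert-profile (All-perms x<xs))) ⟩
    concatMap (insertProfile (length xs) ∘ profile) (perms xs)
      ≡⟨ sym (concatMap-map (insertProfile (length xs)) profile (perms xs)) ⟩
    concatMap (insertProfile (length xs)) (map profile (perms xs))
      ≡⟨ cong (concatMap (insertProfile (length xs))) (map-profile-perms sorted) ⟩
    profiles (length (x ∷ xs)) ∎
    where
      open ≡-Reasoning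
      insert-profile : ∀ {σ} → All (x <_) σ × length σ ≡ length xs →
        map profile (insertions x σ) ≡ insertProfile (length xs) (profile σ)
      insert-profile {σ} (x<σ , len) =
        trans (map-profile-insertions σ x<σ) (cong (λ n → insertProfile n (profile σ)) len)

  coeffR-profiles : ∀ n j → coeffR k n j ≡ countᵇ (λ s → proj₁ s ≡ᵇ j) (profiles n)
  coeffR-profiles n j = begin
    coeffR k n j
      ≡⟨ length-filterᵇ _ (Sn n) ⟩
    countᵇ (λ σ → mmp k σ ≡ᵇ j) (Sn n)
      ≡⟨ sym (countᵇ-map (λ s → proj₁ s ≡ᵇ j) profile (Sn n)) ⟩
    countᵇ (λ s → proj₁ s ≡ᵇ j) (map profile (Sn n))
      ≡⟨ cong (countᵇ _) (map-profile-perms (AllPairs-oneTo n)) ⟩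
    countᵇ (λ s → proj₁ s ≡ᵇ j) (profiles (length (oneTo n)))
      ≡⟨ cong (countᵇ _ ∘ profiles) (length-oneTo n) ⟩
    countᵇ (λ s → proj₁ s ≡ᵇ j) (profiles n) ∎
    where open ≡-Reasoning

  -- Defect coordinates

  -- The last of j matches has k larger entries between it and the maximum, so j + k ≤ q if j > 0.
  Admissible : ℕ → ℕ × ℕ → Set
  Admissible m (j , q) = q ≤ m × (j ≡ 0 ⊎ j + k ≤ q)

  admissible-insertProfile : ∀ m s → Admissible m s → All (Admissible (suc m)) (insertProfile m s)
  admissible-insertProfile m (j , q) (q≤m , j-ok) =
    front ∷ ++⁺ (replicate⁺ (q ∸ 1) (s≤s q≤m , Sum.map₂ m≤n⇒m≤1+n j-ok))
                (replicate⁺ (m ∸ (q ∸ 1)) (m≤n⇒m≤1+n q≤m , j-ok))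
    where
      front : Admissible (suc m) (j + 𝟙 (k ≤ᵇ q) , suc q)
      front with k ≤? q
      ... | yes k≤q rewrite ≤⇒≤ᵇ≡true k≤q = s≤s q≤m , inj₂ (bound j-ok)
        where
          bound : j ≡ 0 ⊎ j + k ≤ q → j + 1 + k ≤ suc q
          bound (inj₁ refl) = s≤s k≤q
          bound (inj₂ j+k≤q) = subst (_≤ suc q) (cong (_+ k) (+-comm 1 j)) (s≤s j+k≤q)
      ... | no k≰q rewrite >⇒≤ᵇ≡false (≰⇒> k≰q) = s≤s q≤m , inj₁ (trans (+-identityʳ j) (no-match j-ok))
        where
          no-match : j ≡ 0 ⊎ j + k ≤ q → j ≡ 0
          no-match (inj₁ j≡0) = j≡0
          no-match (inj₂ j+k≤q) = contradiction (≤-trans (m≤n+m k j) j+k≤q) k≰q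

  admissible-profiles : ∀ m → All (Admissible m) (profiles m)
  admissible-profiles zero = (z≤n , inj₁ refl) ∷ []
  admissible-profiles (suc m) =
    concat⁺ (map⁺ (All.map (admissible-insertProfile m _) (admissible-profiles m)))

  defect : ℕ → ℕ × ℕ → ℕ × ℕ
  defect m (j , q) = q ∸ k ∸ j , m ∸ q

  insertDefect : ℕ → ℕ × ℕ → List (ℕ × ℕ)
  insertDefect m (h , D) =
    (h , D) ∷ (replicate (m ∸ D ∸ 1) (h + 𝟙 (k ≤ᵇ m ∸ D) , D) ++ replicate (m ∸ (m ∸ D ∸ 1)) (h , suc D))

  defects : ℕ → List (ℕ × ℕ)
  defects zero = (0 , 0) ∷ []
  defects (suc m) = concatMap (insertDefect m) (defects m)

  slack-front : ∀ j q → suc q ∸ k ∸ (j + 𝟙 (k ≤ᵇ q)) ≡ q ∸ k ∸ j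
  slack-front j q with k ≤? q
  ... | yes k≤q rewrite ≤⇒≤ᵇ≡true k≤q | +-∸-assoc 1 k≤q | +-comm j 1 = refl
  ... | no k≰q rewrite >⇒≤ᵇ≡false (≰⇒> k≰q) | m≤n⇒m∸n≡0 (≰⇒> k≰q) | m≤n⇒m∸n≡0 (<⇒≤ (≰⇒> k≰q))
                     | 0∸n≡0 (j + 0) | 0∸n≡0 j = refl

  ≤-slack : ∀ {j q} → j ≡ 0 ⊎ j + k ≤ q → j ≤ q ∸ k
  ≤-slack (inj₁ refl) = z≤n
  ≤-slack {j} (inj₂ j+k≤q) = m+n≤o⇒m≤o∸n j j+k≤q

  slack-suc : ∀ j q → j ≡ 0 ⊎ j + k ≤ q → suc q ∸ k ∸ j ≡ q ∸ k ∸ j + 𝟙 (k ≤ᵇ q)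
  slack-suc j q j-ok with k ≤? q
  ... | yes k≤q rewrite ≤⇒≤ᵇ≡true k≤q | +-∸-assoc 1 k≤q | +-∸-assoc 1 (≤-slack j-ok) = +-comm 1 _
  ... | no k≰q rewrite >⇒≤ᵇ≡false (≰⇒> k≰q) | m≤n⇒m∸n≡0 (≰⇒> k≰q) | m≤n⇒m∸n≡0 (<⇒≤ (≰⇒> k≰q))
                     | 0∸n≡0 j = refl

  map-defect-insertProfile : ∀ m s → Admissible m s →
    map (defect (suc m)) (insertProfile m s) ≡ insertDefect m (defect m s)
  map-defect-insertProfile m (j , q) (q≤m , j-ok) rewrite m∸[m∸n]≡n q≤m =
    cong₂ _∷_ (cong (_, m ∸ q) (slack-front j q)) (begin
      map (defect (suc m)) (replicate (q ∸ 1) (j , suc q) ++ replicate (m ∸ (q ∸ 1)) (j , q))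
        ≡⟨ map-++ (defect (suc m)) (replicate (q ∸ 1) (j , suc q)) _ ⟩
      map (defect (suc m)) (replicate (q ∸ 1) (j , suc q)) ++ map (defect (suc m)) (replicate (m ∸ (q ∸ 1)) (j , q))
        ≡⟨ cong₂ _++_ (map-replicate (defect (suc m)) (q ∸ 1) (j , suc q))
                      (map-replicate (defect (suc m)) (m ∸ (q ∸ 1)) (j , q)) ⟩
      replicate (q ∸ 1) (suc q ∸ k ∸ j , m ∸ q) ++ replicate (m ∸ (q ∸ 1)) (q ∸ k ∸ j , suc m ∸ q)
        ≡⟨ cong₂ (λ a b → replicate (q ∸ 1) a ++ replicate (m ∸ (q ∸ 1)) b)
                 (cong (_, m ∸ q) (slack-suc j q j-ok)) (cong (q ∸ k ∸ j ,_) (+-∸-assoc 1 q≤m)) ⟩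
      replicate (q ∸ 1) (q ∸ k ∸ j + 𝟙 (k ≤ᵇ q) , m ∸ q) ++ replicate (m ∸ (q ∸ 1)) (q ∸ k ∸ j , suc (m ∸ q)) ∎)
    where open ≡-Reasoning

  map-defect-profiles : ∀ m → map (defect m) (profiles m) ≡ defects m
  map-defect-profiles zero = refl
  map-defect-profiles (suc m) = begin
    map (defect (suc m)) (concatMap (insertProfile m) (profiles m))
      ≡⟨ map-concatMap (defect (suc m)) (insertProfile m) (profiles m) ⟩
    concatMap (map (defect (suc m)) ∘ insertProfile m) (profiles m)
      ≡⟨ cong concat (map-cong-local (All.map (map-defect-insertProfile m _) (admissible-profiles m))) ⟩
    concatMap (insertDefect m ∘ defect m) (profiles m)
      ≡⟨ sym (concatMap-map (insertDefect m) (defect m) (profiles m)) ⟩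
    concatMap (insertDefect m) (map (defect m) (profiles m))
      ≡⟨ cong (concatMap (insertDefect m)) (map-defect-profiles m) ⟩
    defects (suc m) ∎
    where open ≡-Reasoning

  tally : (ℕ × ℕ → Bool) → ℕ → ℕ × ℕ → ℕ
  tally p m (h , D) = 𝟙 (p (h , D)) +
    ((if p (h + 𝟙 (k ≤ᵇ m ∸ D) , D) then m ∸ D ∸ 1 else 0) + (if p (h , suc D) then m ∸ (m ∸ D ∸ 1) else 0))

  countᵇ-insertDefect : ∀ p m s → countᵇ p (insertDefect m s) ≡ tally p m s
  countᵇ-insertDefect p m (h , D) = cong (𝟙 (p (h , D)) +_) (begin
    countᵇ p (replicate (m ∸ D ∸ 1) e₁ ++ replicate (m ∸ (m ∸ D ∸ 1)) e₂)
      ≡⟨ countᵇ-++ p (replicate (m ∸ D ∸ 1) e₁) _ ⟩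
    countᵇ p (replicate (m ∸ D ∸ 1) e₁) + countᵇ p (replicate (m ∸ (m ∸ D ∸ 1)) e₂)
      ≡⟨ cong₂ _+_ (countᵇ-replicate p (m ∸ D ∸ 1) e₁) (countᵇ-replicate p (m ∸ (m ∸ D ∸ 1)) e₂) ⟩
    (if p e₁ then m ∸ D ∸ 1 else 0) + (if p e₂ then m ∸ (m ∸ D ∸ 1) else 0) ∎)
    where
      open ≡-Reasoning
      e₁ = h + 𝟙 (k ≤ᵇ m ∸ D) , D
      e₂ = h , suc D

  -- Inserting into a profile (h , 0) of size m gives (h , 0) in stay m ways and (h + 1 , 0) in
  -- rise m ways; a profile (h , 1) behaves like (h , 0) one size lower.
  stay rise : ℕ → ℕ
  stay m = 1 + (if k ≤ᵇ m then 0 else m ∸ 1)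
  rise m = if k ≤ᵇ m then m ∸ 1 else 0

  c₀₀ c₁₀ c₀₁ : ℕ → ℕ
  c₀₀ m = countᵇ ((0 , 0) =ᵇ_) (defects m)
  c₁₀ m = countᵇ ((1 , 0) =ᵇ_) (defects m)
  c₀₁ m = countᵇ ((0 , 1) =ᵇ_) (defects m)

  c₀₀-suc : ∀ m → c₀₀ (suc m) ≡ c₀₀ m * stay m
  c₀₀-suc m = begin
    c₀₀ (suc m)
      ≡⟨ countᵇ-concatMap _ ((0 , 0) =ᵇ_) (λ _ → false) (stay m) 0 (insertDefect m) (defects m)
           (λ s → trans (countᵇ-insertDefect _ m s) (tally₀₀ s)) ⟩
    c₀₀ m * stay m + countᵇ (λ _ → false) (defects m) * 0
      ≡⟨ cong (c₀₀ m * stay m +_) (*-zeroʳ (countᵇ (λ _ → false) (defects m))) ⟩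
    c₀₀ m * stay m + 0
      ≡⟨ +-identityʳ _ ⟩
    c₀₀ m * stay m ∎
    where
      open ≡-Reasoning
      tally₀₀ : ∀ s → tally ((0 , 0) =ᵇ_) m s ≡ (if (0 , 0) =ᵇ s then stay m else 0) + 0
      tally₀₀ (zero , zero) with k ≤ᵇ m
      ... | true = refl
      ... | false = refl
      tally₀₀ (suc h , zero) = refl
      tally₀₀ (h , suc D) = refl

  c₁₀-suc : ∀ m → c₁₀ (suc m) ≡ c₁₀ m * stay m + c₀₀ m * rise m
  c₁₀-suc m = countᵇ-concatMap _ ((1 , 0) =ᵇ_) ((0 , 0) =ᵇ_) (stay m) (rise m) (insertDefect m) (defects m)
    (λ s → trans (countᵇ-insertDefect _ m s) (tally₁₀ s))
    where
      tally₁₀ : ∀ s → tally ((1 , 0) =ᵇ_) m s ≡ (if (1 , 0) =ᵇ s then stay m else 0) + (if (0 , 0) =ᵇ s then rise m else 0)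
      tally₁₀ (zero , zero) with k ≤ᵇ m
      ... | true = +-identityʳ (m ∸ 1)
      ... | false = refl
      tally₁₀ (suc zero , zero) with k ≤ᵇ m
      ... | true = refl
      ... | false = refl
      tally₁₀ (suc (suc h) , zero) = refl
      tally₁₀ (h , suc D) = refl

  c₀₁-suc : ∀ m → c₀₁ (suc m) ≡ c₀₁ m * stay (m ∸ 1) + c₀₀ m * (m ∸ (m ∸ 1))
  c₀₁-suc m = countᵇ-concatMap _ ((0 , 1) =ᵇ_) ((0 , 0) =ᵇ_) (stay (m ∸ 1)) (m ∸ (m ∸ 1)) (insertDefect m) (defects m)
    (λ s → trans (countᵇ-insertDefect _ m s) (tally₀₁ s))
    where
      tally₀₁ : ∀ s → tally ((0 , 1) =ᵇ_) m s ≡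
        (if (0 , 1) =ᵇ s then stay (m ∸ 1) else 0) + (if (0 , 0) =ᵇ s then m ∸ (m ∸ 1) else 0)
      tally₀₁ (zero , zero) = refl
      tally₀₁ (suc h , zero) = refl
      tally₀₁ (zero , suc zero) with k ≤ᵇ m ∸ 1
      ... | true = refl
      ... | false = refl
      tally₀₁ (suc h , suc zero) = refl
      tally₀₁ (h , suc (suc D)) = refl

  -- Closed forms

  c₀₀-≤ : ∀ m → m ≤ k → c₀₀ m ≡ (m ∸ 1) !
  c₀₀-≤ zero _ = refl
  c₀₀-≤ (suc m) m<k rewrite c₀₀-suc m | c₀₀-≤ m (<⇒≤ m<k) | >⇒≤ᵇ≡false m<k = pred-!-* m
    where
      pred-!-* : ∀ m → (m ∸ 1) ! * (1 + (m ∸ 1)) ≡ m !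
      pred-!-* zero = refl
      pred-!-* (suc m) = *-comm (m !) (suc m)

  c₀₀-≥ : ∀ m → k ≤ m → c₀₀ m ≡ k₀ !
  c₀₀-≥ (suc m) k≤1+m with m≤n⇒m<n∨m≡n k≤1+m
  ... | inj₂ refl = c₀₀-≤ k ≤-refl
  ... | inj₁ (s≤s k≤m) rewrite c₀₀-suc m | c₀₀-≥ m k≤m | ≤⇒≤ᵇ≡true k≤m = *-identityʳ (k₀ !)

  c₁₀-≤ : ∀ m → m ≤ k → c₁₀ m ≡ 0
  c₁₀-≤ zero _ = refl
  c₁₀-≤ (suc m) m<k rewrite c₁₀-suc m | c₁₀-≤ m (<⇒≤ m<k) | >⇒≤ᵇ≡false m<k = *-zeroʳ (c₀₀ m)

  c₁₀-≥ : ∀ m → k₀ ≤ m → c₁₀ (suc m) + k₀ ! * (k₀ C 2) ≡ k₀ ! * (m C 2)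
  c₁₀-≥ m k₀≤m with m≤n⇒m<n∨m≡n k₀≤m
  ... | inj₂ refl rewrite c₁₀-≤ k ≤-refl = refl
  ... | inj₁ (s≤s {n = m′} k₀≤m′)
    rewrite c₁₀-suc (suc m′) | c₀₀-≥ (suc m′) (s≤s k₀≤m′) | ≤⇒≤ᵇ≡true {k} {suc m′} (s≤s k₀≤m′) = begin
    c₁₀ (suc m′) * 1 + k₀ ! * m′ + k₀ ! * (k₀ C 2)
      ≡⟨ cong (λ c → c + k₀ ! * m′ + k₀ ! * (k₀ C 2)) (*-identityʳ (c₁₀ (suc m′))) ⟩
    c₁₀ (suc m′) + k₀ ! * m′ + k₀ ! * (k₀ C 2)
      ≡⟨ xy∙z≈xz∙y (c₁₀ (suc m′)) (k₀ ! * m′) (k₀ ! * (k₀ C 2)) ⟩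
    c₁₀ (suc m′) + k₀ ! * (k₀ C 2) + k₀ ! * m′
      ≡⟨ cong (_+ k₀ ! * m′) (c₁₀-≥ m′ k₀≤m′) ⟩
    k₀ ! * (m′ C 2) + k₀ ! * m′
      ≡⟨ sym (*-distribˡ-+ (k₀ !) (m′ C 2) m′) ⟩
    k₀ ! * (m′ C 2 + m′)
      ≡⟨ cong (k₀ ! *_) (C2-suc m′) ⟩
    k₀ ! * (suc m′ C 2) ∎
    where open ≡-Reasoning

  c₀₁-≤ : ∀ m → m < k → c₀₁ (2 + m) ≡ (1 + m) !
  c₀₁-≤ zero _ = refl
  c₀₁-≤ (suc m) 1+m<k
    rewrite c₀₁-suc (2 + m) | c₀₁-≤ m (<⇒≤ 1+m<k) | c₀₀-≤ (2 + m) 1+m<k | >⇒≤ᵇ≡false {k} {suc m} 1+m<k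
          | m+n∸n≡m 1 (suc m) = factorial-step ((1 + m) !) m
    where
      factorial-step : ∀ x m → x * (1 + m) + x * 1 ≡ (2 + m) * x
      factorial-step = solve-∀

  c₀₁-≥ : ∀ m → k₀ ≤ m → c₀₁ (2 + m) ≡ k₀ ! * (1 + m)
  c₀₁-≥ m k₀≤m with m≤n⇒m<n∨m≡n k₀≤m
  ... | inj₂ refl = trans (c₀₁-≤ k₀ ≤-refl) (*-comm k (k₀ !))
  ... | inj₁ (s≤s {n = m′} k₀≤m′)
    rewrite c₀₁-suc (2 + m′) | c₀₁-≥ m′ k₀≤m′ | c₀₀-≥ (2 + m′) (s≤s (m≤n⇒m≤1+n k₀≤m′))
          | ≤⇒≤ᵇ≡true {k} {suc m′} (s≤s k₀≤m′) | m+n∸n≡m 1 (suc m′) = linear-step (k₀ !) m′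
    where
      linear-step : ∀ x m → x * (1 + m) * 1 + x * 1 ≡ x * (2 + m)
      linear-step = solve-∀

  topMatch-defect-within : ∀ j h D → k + 2 ≤ j + k + h + D →
    𝟙 (j ≡ᵇ j + k + h + D ∸ k ∸ 1) ≡
      𝟙 ((1 , 0) =ᵇ defect (j + k + h + D) (j , j + k + h)) + 𝟙 ((0 , 1) =ᵇ defect (j + k + h + D) (j , j + k + h))
  topMatch-defect-within j h D k+2≤n
    rewrite m+n∸m≡n (j + k + h) D | m+n+o∸n∸m≡o j k h | m+n+o+p∸n≡m+[o+p] j k h D
    = trans (𝟙-≡ᵇ-pred j (h + D) 2≤j+h+D) (𝟙-+≡ᵇ1 h D)
    where
      2≤j+h+D : 2 ≤ j + (h + D)
      2≤j+h+D = +-cancelˡ-≤ k 2 (j + (h + D)) (subst (k + 2 ≤_) (m+n+o+p≡n+[m+[o+p]] j k h D) k+2≤n)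

  topMatch-defect : ∀ n s → k + 2 ≤ n → Admissible n s →
    𝟙 (proj₁ s ≡ᵇ n ∸ k ∸ 1) ≡ 𝟙 ((1 , 0) =ᵇ defect n s) + 𝟙 ((0 , 1) =ᵇ defect n s)
  topMatch-defect n (j , q) k+2≤n (q≤n , inj₂ j+k≤q)
    with m≤n⇒∃[o]m+o≡n j+k≤q | m≤n⇒∃[o]m+o≡n q≤n
  ... | h , refl | D , refl = topMatch-defect-within j h D k+2≤n
  topMatch-defect n (0 , q) k+2≤n (q≤n , inj₁ refl) with k ≤? q
  ... | yes k≤q = topMatch-defect n (0 , q) k+2≤n (q≤n , inj₂ k≤q)
  ... | no k≰q with m≤n⇒∃[o]m+o≡n q≤n
  ...   | D , refl rewrite m+n∸m≡n q D | m≤n⇒m∸n≡0 (<⇒≤ (≰⇒> k≰q)) =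
    trans (cong 𝟙 (≢⇒≡ᵇ≡false (<⇒≢ 0<n∸k∸1))) (trans (cong 𝟙 (sym (≢⇒≡ᵇ≡false (>⇒≢ 2≤D)))) (𝟙-+≡ᵇ1 0 D))
    where
      q<k : q < k
      q<k = ≰⇒> k≰q
      0<n∸k∸1 : 0 < q + D ∸ k ∸ 1
      0<n∸k∸1 = ∸-monoˡ-≤ 1 (m+n≤o⇒m≤o∸n 2 (subst (_≤ q + D) (+-comm k 2) k+2≤n))
      2≤D : 2 ≤ D
      2≤D = +-cancelˡ-≤ q 2 D (≤-trans (+-monoˡ-≤ 2 (<⇒≤ q<k)) k+2≤n)

  coeffR-top : ∀ n → k + 2 ≤ n → coeffR k n (n ∸ k ∸ 1) ≡ c₁₀ n + c₀₁ n
  coeffR-top n k+2≤n = begin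
    coeffR k n (n ∸ k ∸ 1)
      ≡⟨ coeffR-profiles n (n ∸ k ∸ 1) ⟩
    countᵇ (λ s → proj₁ s ≡ᵇ n ∸ k ∸ 1) (profiles n)
      ≡⟨ countᵇ-split _ _ _ (All.map (topMatch-defect n _ k+2≤n) (admissible-profiles n)) ⟩
    countᵇ (((1 , 0) =ᵇ_) ∘ defect n) (profiles n) + countᵇ (((0 , 1) =ᵇ_) ∘ defect n) (profiles n)
      ≡⟨ sym (cong₂ _+_ (countᵇ-map _ (defect n) (profiles n)) (countᵇ-map _ (defect n) (profiles n))) ⟩
    countᵇ ((1 , 0) =ᵇ_) (map (defect n) (profiles n)) + countᵇ ((0 , 1) =ᵇ_) (map (defect n) (profiles n))
      ≡⟨ cong (λ L → countᵇ ((1 , 0) =ᵇ_) L + countᵇ ((0 , 1) =ᵇ_) L) (map-defect-profiles n) ⟩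
    c₁₀ n + c₀₁ n ∎
    where open ≡-Reasoning

  c₁₀+c₀₁ : ∀ m → k₀ ≤ m → c₁₀ (2 + m) + c₀₁ (2 + m) ≡ k₀ ! * ((2 + m) C 2 ∸ k₀ C 2)
  c₁₀+c₀₁ m k₀≤m = begin
    c₁₀ (2 + m) + c₀₁ (2 + m)
      ≡⟨ sym (m+n∸n≡m _ (k₀ ! * (k₀ C 2))) ⟩
    c₁₀ (2 + m) + c₀₁ (2 + m) + k₀ ! * (k₀ C 2) ∸ k₀ ! * (k₀ C 2)
      ≡⟨ cong (_∸ k₀ ! * (k₀ C 2)) total ⟩
    k₀ ! * ((2 + m) C 2) ∸ k₀ ! * (k₀ C 2)
      ≡⟨ sym (*-distribˡ-∸ (k₀ !) ((2 + m) C 2) (k₀ C 2)) ⟩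
    k₀ ! * ((2 + m) C 2 ∸ k₀ C 2) ∎
    where
      open ≡-Reasoning
      total : c₁₀ (2 + m) + c₀₁ (2 + m) + k₀ ! * (k₀ C 2) ≡ k₀ ! * ((2 + m) C 2)
      total = begin
        c₁₀ (2 + m) + c₀₁ (2 + m) + k₀ ! * (k₀ C 2)
          ≡⟨ xy∙z≈xz∙y (c₁₀ (2 + m)) (c₀₁ (2 + m)) (k₀ ! * (k₀ C 2)) ⟩
        c₁₀ (2 + m) + k₀ ! * (k₀ C 2) + c₀₁ (2 + m)
          ≡⟨ cong₂ _+_ (c₁₀-≥ (1 + m) (m≤n⇒m≤1+n k₀≤m)) (c₀₁-≥ m k₀≤m) ⟩
        k₀ ! * ((1 + m) C 2) + k₀ ! * (1 + m)
          ≡⟨ sym (*-distribˡ-+ (k₀ !) ((1 + m) C 2) (1 + m)) ⟩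
        k₀ ! * ((1 + m) C 2 + (1 + m))
          ≡⟨ cong (k₀ ! *_) (C2-suc (1 + m)) ⟩
        k₀ ! * ((2 + m) C 2) ∎

mainTheorem11 : (k n : ℕ) → 1 ≤ k → k + 2 ≤ n →
    coeffR k n (n ∸ k ∸ 1) ≡ ((k ∸ 1) !) * (n C 2 ∸ (k ∸ 1) C 2)
mainTheorem11 zero n () _
mainTheorem11 (suc k₀) n _ k+2≤n with ≤-trans (m≤n+m 2 (suc k₀)) k+2≤n
... | s≤s (s≤s _) =
  trans (coeffR-top k₀ n k+2≤n) (c₁₀+c₀₁ k₀ _ (<⇒≤ (m+n≤o⇒m≤o∸n (suc k₀) k+2≤n)))
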